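{- Let $d \geq 1$. There is no tiling of $\mathbb{Z}^d$ by Cartesian cosets in which no two of the tiles are translates of one another. Equivalently: if $\mathbb{Z}^d$ is the disjoint union of finitely many Cartesian cosets $T_1, \dots, T_n$ with $n \geq 2$, then there exist $i \neq j$ such that $T_j = \mathbf{w} + T_i$ for some $\mathbf{w} \in \mathbb{Z}^d$.
   Context: A Cartesian coset in $\mathbb{Z}^d$ is a set of the form $\mathbf{v} + L$ where $\mathbf{v} \in \mathbb{Z}^d$ and $L = a_1\mathbb{Z} \times \cdots \times a_d\mathbb{Z}$ for positive integers $a_1, \dots, a_d$ (i.e., a Cartesian product of $d$ arithmetic progressions with positive common differences). A tiling of a set $S$ is a nontrivial (at least two members) finite family of pairwise disjoint sets whose union is $S$; its members are called tiles. -}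

module Defs where

open import Data.Nat using (ℕ; _≥_; _>_)
open import Data.Integer using (ℤ; _-_; _+_; +_)
open import Data.Integer.Divisibility using (_∣_)
open import Data.Fin using (Fin)
open import Data.Product using (_×_; ∃)
open import Data.Empty using (⊥)
open import Relation.Nullary using (¬_)
open import Relation.Binary.PropositionalEquality using (_≡_)

Point : ℕ → Set
Point d = Fin d → ℤ

record Coset (d : ℕ) : Set where
  constructor coset
  field
    base    : Point d
    moduli  : Fin d → ℕ
    moduli-pos : ∀ i → moduli i > 0

open Coset public

_∈C_ : ∀ {d} → Point d → Coset d → Set
x ∈C C = ∀ i → (+ moduli C i) ∣ (x i - base C i)

-- Translate of a point set: w + S = { y | y - w ∈ S }, so membership
-- of x in w + T is (λ i → x i - w i) ∈ T
-- A tiling of ℤ^d by Cartesian cosets T₀,…,T_{n-1}: n ≥ 2, pairwise disjoint,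
-- union is all of ℤ^d.
IsTiling : ∀ {d n} → (Fin n → Coset d) → Set
IsTiling {d} {n} T =
  (n ≥ 2)
  × (∀ i j → ¬ (i ≡ j) → ∀ (x : Point d) → x ∈C T i → x ∈C T j → ⊥)
  × (∀ (x : Point d) → ∃ λ i → x ∈C T i)

IsTranslateBy : ∀ {d} → Point d → Coset d → Coset d → Set
IsTranslateBy {d} w T T' =
  ∀ (x : Point d) → (x ∈C T' → (λ i → x i - w i) ∈C T)
                  × ((λ i → x i - w i) ∈C T → x ∈C T')

module Submission where

-- For every modulus m there is an m-periodic weight ψ : ℕ → ℤ with ψ 0 ≢ 0 whose sum over m
-- consecutive terms of an arithmetic progression vanishes unless m divides the common difference
-- (an integer-valued substitute for the Ramanujan sum c_m, built from p · [p ∣ t] − 1 along the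
-- prime factorisation of m).  Fix a tile T_k = v + (m₁ℤ × ⋯ × m_dℤ) and weight x ∈ ℤ^d by
-- ∏ⱼ ψ_{mⱼ}(xⱼ − vⱼ).  Summed over a box whose sides are multiples of all moduli, T_k gets nonzero
-- weight, whereas a tile whose j-th modulus is not a multiple of mⱼ gets weight 0, and so does
-- ℤ^d itself as soon as some mⱼ ≠ 1.  As the tiles partition ℤ^d, some other tile has moduli that
-- are multiples of those of T_k; if T_k has the largest sum of moduli, they are equal and the two
-- tiles are translates of each other.

open import Defs
open import Data.Empty using (⊥-elim)
open import Data.Fin.Base using (Fin; zero; suc)
import Data.Fin.Properties as Fin
open import Data.Integer.Base as ℤ using (ℤ; +_; -_; 0ℤ; 1ℤ; -1ℤ)
import Data.Integer.Divisibility as ℤ∣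
import Data.Integer.Divisibility.Signed as ℤ∣ˢ
open import Data.Integer.DivMod using (_%ℕ_; _/ℕ_; a≡a%ℕn+[a/ℕn]*n; n%ℕd<d)
import Data.Integer.Properties as ℤ
open import Algebra.Properties.CommutativeSemigroup ℤ.+-commutativeSemigroup using (interchange)
open import Data.Integer.Tactic.RingSolver as ℤ-Solver using ()
open import Data.List.Base using ([]; _∷_; tabulate; allFin)
open import Data.List.Extrema.Nat using (argmax; f[xs]≤f[argmax])
open import Data.List.Membership.Propositional.Properties using (∈-tabulate⁺; ∈-allFin)
open import Data.List.Relation.Unary.All as All using (All; []; _∷_)
open import Data.List.Relation.Unary.All.Properties using (tabulate⁺)
open import Data.Nat.Base using (ℕ; zero; suc; pred; _+_; _*_; _<_; _≤_; _≥_; z≤n; s≤s; NonZero; >-nonZero)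
open import Data.Nat.Coprimality as Coprime using (Coprime; coprime-Bézout; coprime-divisor)
open import Data.Nat.Divisibility
  using ( _∣_; _∤_; _∣?_; divides; ∣-refl; ∣-trans; 1∣_; _∣0; ∣⇒≤
        ; ∣m+n∣m⇒∣n; ∣m∣n⇒∣m+n; ∣n⇒∣m*n; n∣m*n; m∣m*n; *-monoʳ-∣)
open import Data.Nat.DivMod using (_%_; _/_; m≡m%n+[m/n]*n; m%n<n; +-distrib-/-∣ʳ; m*n/n≡m; 0/n≡0)
open import Data.Nat.GCD using (module Bézout)
open import Data.Nat.ListAction using (product)
open import Data.Nat.ListAction.Properties using (∈⇒∣product; product≢0)
open import Data.Nat.Primality using (Prime; euclidsLemma; prime⇒irreducible; prime⇒nonZero)
open import Data.Nat.Primality.Factorisation using (PrimeFactorisation; factorise)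
import Data.Nat.Properties as ℕ
open import Data.Nat.Tactic.RingSolver using (solve-∀)
open import Data.Product using (Σ; ∃; _×_; _,_; proj₁; proj₂)
open import Data.Sum using (inj₁; inj₂; [_,_]′)
open import Data.Vec.Functional using (head; tail)
import Data.Vec.Functional as Vector using (_∷_)
open import Function using (_∘_)
open import Relation.Binary.PropositionalEquality
open import Relation.Nullary using (¬_; Dec; yes; no; ¬?; contradiction)
open import Relation.Nullary.Decidable using (_×-dec_)

-- Finite sums over ranges

∑ : ℕ → (ℕ → ℤ) → ℤ
∑ zero    f = 0ℤ
∑ (suc n) f = ∑ n f ℤ.+ f n

syntax ∑ n (λ i → x) = ∑[ i < n ] x

Periodic : ℕ → (ℕ → ℤ) → Set
Periodic c f = ∀ t → f (t + c) ≡ f t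

Periodic-* : ∀ {c f} → Periodic c f → ∀ q → Periodic (q * c) f
Periodic-* {f = f} per zero t = cong f (ℕ.+-identityʳ t)
Periodic-* {c} {f} per (suc q) t = begin
  f (t + (c + q * c)) ≡⟨ cong f (trans (cong (_+_ t) (ℕ.+-comm c (q * c))) (sym (ℕ.+-assoc t (q * c) c))) ⟩
  f (t + q * c + c)   ≡⟨ per _ ⟩
  f (t + q * c)       ≡⟨ Periodic-* per q t ⟩
  f t                 ∎
  where open ≡-Reasoning

Periodic-∣ : ∀ {c n f} → Periodic c f → c ∣ n → Periodic n f
Periodic-∣ {f = f} per (divides q refl) = Periodic-* per q

Periodic-progression : ∀ {c h} → Periodic c h → ∀ t a → Periodic c (λ i → h (t + i * a))
Periodic-progression {c} {h} per t a i = trans (cong h (regroup t i c a)) (Periodic-* per a (t + i * a))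
  where
  regroup : ∀ t i c a → t + (i + c) * a ≡ t + i * a + a * c
  regroup = solve-∀

∑-cong : ∀ n {f g} → (∀ i → f i ≡ g i) → ∑ n f ≡ ∑ n g
∑-cong zero    f≗g = refl
∑-cong (suc n) f≗g = cong₂ ℤ._+_ (∑-cong n f≗g) (f≗g n)

∑-vanishes : ∀ n {f} → (∀ i → i < n → f i ≡ 0ℤ) → ∑ n f ≡ 0ℤ
∑-vanishes zero    f≗0 = refl
∑-vanishes (suc n) f≗0 = cong₂ ℤ._+_ (∑-vanishes n (λ i i<n → f≗0 i (ℕ.m<n⇒m<1+n i<n))) (f≗0 n ℕ.≤-refl)

∑-*-vanishes : ∀ n (f : ℕ → ℤ) {g : ℕ → ℤ} → (∀ i → g i ≡ 0ℤ) → ∑[ i < n ] (f i ℤ.* g i) ≡ 0ℤ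
∑-*-vanishes n f g≗0 = ∑-vanishes n (λ i _ → trans (cong (f i ℤ.*_) (g≗0 i)) (ℤ.*-zeroʳ (f i)))

∑-+ : ∀ n f g → ∑[ i < n ] (f i ℤ.+ g i) ≡ ∑ n f ℤ.+ ∑ n g
∑-+ zero    f g = refl
∑-+ (suc n) f g = trans (cong (ℤ._+ (f n ℤ.+ g n)) (∑-+ n f g)) (interchange (∑ n f) (∑ n g) (f n) (g n))

∑-*ˡ : ∀ n c f → ∑[ i < n ] (c ℤ.* f i) ≡ c ℤ.* ∑ n f
∑-*ˡ zero    c f = sym (ℤ.*-zeroʳ c)
∑-*ˡ (suc n) c f = trans (cong (ℤ._+ (c ℤ.* f n)) (∑-*ˡ n c f)) (sym (ℤ.*-distribˡ-+ c (∑ n f) (f n)))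

∑-*ʳ : ∀ n c f → ∑[ i < n ] (f i ℤ.* c) ≡ ∑ n f ℤ.* c
∑-*ʳ n c f = trans (∑-cong n (λ i → ℤ.*-comm (f i) c)) (trans (∑-*ˡ n c f) (ℤ.*-comm c (∑ n f)))

∑-const : ∀ n c → ∑[ i < n ] c ≡ + n ℤ.* c
∑-const zero    c = refl
∑-const (suc n) c = begin
  ∑[ i < n ] c ℤ.+ c            ≡⟨ cong₂ ℤ._+_ (∑-const n c) (sym (ℤ.*-identityˡ c)) ⟩
  + n ℤ.* c ℤ.+ + 1 ℤ.* c       ≡⟨ ℤ.*-distribʳ-+ c (+ n) (+ 1) ⟨
  (+ n ℤ.+ + 1) ℤ.* c           ≡⟨ cong (λ k → + k ℤ.* c) (ℕ.+-comm n 1) ⟩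
  + suc n ℤ.* c                 ∎
  where open ≡-Reasoning

∑-sucˡ : ∀ n f → ∑ (suc n) f ≡ f 0 ℤ.+ ∑ n (f ∘ suc)
∑-sucˡ zero    f = trans (ℤ.+-identityˡ (f 0)) (sym (ℤ.+-identityʳ (f 0)))
∑-sucˡ (suc n) f = trans (cong (ℤ._+ f (suc n)) (∑-sucˡ n f)) (ℤ.+-assoc (f 0) _ _)

∑-++ : ∀ m n f → ∑ (m + n) f ≡ ∑ m f ℤ.+ ∑[ i < n ] f (m + i)
∑-++ m zero    f = trans (cong (λ k → ∑ k f) (ℕ.+-identityʳ m)) (sym (ℤ.+-identityʳ _))
∑-++ m (suc n) f = begin
  ∑ (m + suc n) f                            ≡⟨ cong (λ k → ∑ k f) (ℕ.+-suc m n) ⟩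
  ∑ (m + n) f ℤ.+ f (m + n)                  ≡⟨ cong (ℤ._+ f (m + n)) (∑-++ m n f) ⟩
  ∑ m f ℤ.+ ∑[ i < n ] f (m + i) ℤ.+ f (m + n) ≡⟨ ℤ.+-assoc (∑ m f) _ _ ⟩
  ∑ m f ℤ.+ ∑[ i < suc n ] f (m + i)         ∎
  where open ≡-Reasoning

∑-comm : ∀ m n (f : ℕ → ℕ → ℤ) → ∑[ i < m ] ∑[ j < n ] f i j ≡ ∑[ j < n ] ∑[ i < m ] f i j
∑-comm zero    n f = sym (∑-vanishes n (λ _ _ → refl))
∑-comm (suc m) n f = trans (cong (ℤ._+ ∑[ j < n ] f m j) (∑-comm m n f)) (sym (∑-+ n (λ j → ∑[ i < m ] f i j) (f m)))

∑-blocks : ∀ q b f → ∑ (q * b) f ≡ ∑[ j < q ] ∑[ i < b ] f (j * b + i)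
∑-blocks zero    b f = refl
∑-blocks (suc q) b f = begin
  ∑ (b + q * b) f
    ≡⟨ ∑-++ b (q * b) f ⟩
  ∑ b f ℤ.+ ∑[ i < q * b ] f (b + i)
    ≡⟨ cong (ℤ._+_ (∑ b f)) (∑-blocks q b (λ i → f (b + i))) ⟩
  ∑ b f ℤ.+ ∑[ j < q ] ∑[ i < b ] f (b + (j * b + i))
    ≡⟨ cong (ℤ._+_ (∑ b f)) (∑-cong q (λ j → ∑-cong b (λ i → cong f (ℕ.+-assoc b (j * b) i)))) ⟨
  ∑ b f ℤ.+ ∑[ j < q ] ∑[ i < b ] f (suc j * b + i)
    ≡⟨ ∑-sucˡ q (λ j → ∑[ i < b ] f (j * b + i)) ⟨
  ∑[ j < suc q ] ∑[ i < b ] f (j * b + i) ∎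
  where open ≡-Reasoning

∑-residues : ∀ q b f → ∑ (q * b) f ≡ ∑[ i < b ] ∑[ j < q ] f (j * b + i)
∑-residues q b f = trans (∑-blocks q b f) (∑-comm q b _)

∑-*-periodic : ∀ {c f} → Periodic c f → ∀ k (g : ℕ → ℤ) →
               ∑[ i < k * c ] (f i ℤ.* g i) ≡ ∑[ r < c ] (f r ℤ.* ∑[ j < k ] g (j * c + r))
∑-*-periodic {c} {f} per k g = begin
  ∑[ i < k * c ] (f i ℤ.* g i)
    ≡⟨ ∑-residues k c (λ i → f i ℤ.* g i) ⟩
  ∑[ r < c ] ∑[ j < k ] (f (j * c + r) ℤ.* g (j * c + r))
    ≡⟨ ∑-cong c (λ r → ∑-cong k (λ j → cong (ℤ._* g (j * c + r)) (f-periodic r j))) ⟩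
  ∑[ r < c ] ∑[ j < k ] (f r ℤ.* g (j * c + r))
    ≡⟨ ∑-cong c (λ r → ∑-*ˡ k (f r) (λ j → g (j * c + r))) ⟩
  ∑[ r < c ] (f r ℤ.* ∑[ j < k ] g (j * c + r)) ∎
  where
  open ≡-Reasoning
  f-periodic : ∀ r j → f (j * c + r) ≡ f r
  f-periodic r j = trans (cong f (ℕ.+-comm (j * c) r)) (Periodic-* per j r)

∑-single : ∀ n f i₀ → i₀ < n → (∀ i → i < n → i ≢ i₀ → f i ≡ 0ℤ) → ∑ n f ≡ f i₀
∑-single (suc n) f i₀ i₀<1+n others with i₀ ℕ.≟ n
... | yes refl = trans (cong (ℤ._+ f n) (∑-vanishes n (λ i i<n → others i (ℕ.m<n⇒m<1+n i<n) (ℕ.<⇒≢ i<n))))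
                      (ℤ.+-identityˡ (f n))
... | no i₀≢n  = trans (cong₂ ℤ._+_ (∑-single n f i₀ (ℕ.≤∧≢⇒< (ℕ.≤-pred i₀<1+n) i₀≢n) (λ i i<n → others i (ℕ.m<n⇒m<1+n i<n)))
                                    (others n ℕ.≤-refl (i₀≢n ∘ sym)))
                      (ℤ.+-identityʳ (f i₀))

∑-nonneg : ∀ n {f} → (∀ i → 0ℤ ℤ.≤ f i) → 0ℤ ℤ.≤ ∑ n f
∑-nonneg zero    f≥0 = ℤ.≤-refl
∑-nonneg (suc n) f≥0 = ℤ.+-mono-≤ (∑-nonneg n f≥0) (f≥0 n)

∑-pos : ∀ n {f} i₀ → (∀ i → 0ℤ ℤ.≤ f i) → i₀ < n → 0ℤ ℤ.< f i₀ → 0ℤ ℤ.< ∑ n f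
∑-pos (suc n) i₀ f≥0 i₀<1+n fi₀>0 with i₀ ℕ.≟ n
... | yes refl = ℤ.+-mono-≤-< (∑-nonneg n f≥0) fi₀>0
... | no i₀≢n  = ℤ.+-mono-<-≤ (∑-pos n i₀ f≥0 (ℕ.≤∧≢⇒< (ℕ.≤-pred i₀<1+n) i₀≢n) fi₀>0) (f≥0 n)

-- Weights annihilating arithmetic progressions

𝟙 : ∀ {P : Set} → Dec P → ℤ
𝟙 (yes _) = 1ℤ
𝟙 (no _)  = 0ℤ

𝟙-yes : ∀ {P : Set} (d : Dec P) → P → 𝟙 d ≡ 1ℤ
𝟙-yes (yes _) _  = refl
𝟙-yes (no ¬p) p = ⊥-elim (¬p p)

𝟙-no : ∀ {P : Set} (d : Dec P) → ¬ P → 𝟙 d ≡ 0ℤ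
𝟙-no (yes p) ¬p = ⊥-elim (¬p p)
𝟙-no (no _)  _  = refl

𝟙-nonneg : ∀ {P : Set} (d : Dec P) → 0ℤ ℤ.≤ 𝟙 d
𝟙-nonneg (yes _) = ℤ.+≤+ z≤n
𝟙-nonneg (no _)  = ℤ.≤-refl

𝟙-cong : ∀ {P Q : Set} → (P → Q) → (Q → P) → (dP : Dec P) (dQ : Dec Q) → 𝟙 dP ≡ 𝟙 dQ
𝟙-cong P⇒Q Q⇒P (yes p) dQ = sym (𝟙-yes dQ (P⇒Q p))
𝟙-cong P⇒Q Q⇒P (no ¬p) dQ = sym (𝟙-no dQ (¬p ∘ Q⇒P))

𝟙-∣-periodic : ∀ p → Periodic p (λ t → 𝟙 (p ∣? t))
𝟙-∣-periodic p t = 𝟙-cong (λ p∣t+p → ∣m+n∣m⇒∣n (subst (p ∣_) (ℕ.+-comm t p) p∣t+p) ∣-refl)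
                          (λ p∣t → ∣m∣n⇒∣m+n p∣t ∣-refl) _ _

record Annihilator (m : ℕ) (ψ : ℕ → ℤ) : Set where
  field
    periodic    : Periodic m ψ
    annihilates : ∀ {a} → m ∤ a → ∀ t → ∑[ i < m ] ψ (t + i * a) ≡ 0ℤ
    nonzero     : ψ 0 ≢ 0ℤ

  annihilates-* : ∀ {a} → m ∤ a → ∀ c t → ∑[ i < c * m ] ψ (t + i * a) ≡ 0ℤ
  annihilates-* {a} m∤a c t = begin
    ∑[ i < c * m ] ψ (t + i * a)
      ≡⟨ ∑-blocks c m _ ⟩
    ∑[ u < c ] ∑[ i < m ] ψ (t + (u * m + i) * a)
      ≡⟨ ∑-cong c (λ u → ∑-cong m (λ i → cong ψ (shift t u m i a))) ⟩
    ∑[ u < c ] ∑[ i < m ] ψ (t + u * m * a + i * a)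
      ≡⟨ ∑-vanishes c (λ u _ → annihilates m∤a (t + u * m * a)) ⟩
    0ℤ ∎
    where
    open ≡-Reasoning
    shift : ∀ t u m i a → t + (u * m + i) * a ≡ t + u * m * a + i * a
    shift = solve-∀

primeWeight : ℕ → ℕ → ℤ
primeWeight p t = + p ℤ.* 𝟙 (p ∣? t) ℤ.- 1ℤ

prime∤⇒coprime : ∀ {p a} → Prime p → p ∤ a → Coprime p a
prime∤⇒coprime p-prime p∤a (d∣p , d∣a) with prime⇒irreducible p-prime d∣p
... | inj₁ d≡1  = d≡1
... | inj₂ refl = ⊥-elim (p∤a d∣a)

module _ {p a} (p-prime : Prime p) (p∤a : p ∤ a) where

  private instance
    p≢0 : NonZero p
    p≢0 = prime⇒nonZero p-prime

  ∃-negative-inverse : ∃ λ y → p ∣ 1 + y * a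
  ∃-negative-inverse with coprime-Bézout (prime∤⇒coprime p-prime p∤a)
  ... | Bézout.+- x y 1+ya≡xp = y , divides x 1+ya≡xp
  ... | Bézout.-+ x y 1+xp≡ya = pred p * y , divides (1 + pred p * x) (begin
    1 + pred p * y * a             ≡⟨ cong suc (ℕ.*-assoc (pred p) y a) ⟩
    1 + pred p * (y * a)           ≡⟨ cong (λ z → 1 + pred p * z) 1+xp≡ya ⟨
    1 + pred p * (1 + x * p)       ≡⟨ expand (pred p) x p ⟩
    suc (pred p) + pred p * x * p  ≡⟨ cong (λ z → z + pred p * x * p) (ℕ.suc-pred p) ⟩
    p + pred p * x * p             ≡⟨ factor p (pred p) x ⟩
    (1 + pred p * x) * p           ∎)
    where
    open ≡-Reasoning
    expand : ∀ q x p → 1 + q * (1 + x * p) ≡ suc q + q * x * p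
    expand = solve-∀
    factor : ∀ p q x → p + q * x * p ≡ (1 + q * x) * p
    factor = solve-∀

  ∃-solution : ∀ t → ∃ λ i → i < p × p ∣ t + i * a
  ∃-solution t with ∃-negative-inverse
  ... | y , p∣1+ya = t * y % p , m%n<n (t * y) p , reduce (t * y) p∣t+tya
    where
    p∣t+tya : p ∣ t + t * y * a
    p∣t+tya = subst (p ∣_) (factor t y a) (∣n⇒∣m*n t p∣1+ya)
      where
      factor : ∀ t y a → t * (1 + y * a) ≡ t + t * y * a
      factor = solve-∀
    reduce : ∀ i → p ∣ t + i * a → p ∣ t + i % p * a
    reduce i p∣t+ia = ∣m+n∣m⇒∣n (subst (p ∣_) split p∣t+ia) (n∣m*n (i / p * a))
      where
      regroup : ∀ t r q p a → t + (r + q * p) * a ≡ q * a * p + (t + r * a)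
      regroup = solve-∀
      split : t + i * a ≡ i / p * a * p + (t + i % p * a)
      split = trans (cong (λ j → t + j * a) (m≡m%n+[m/n]*n i p)) (regroup t (i % p) (i / p) p a)

  private
    solution-unique-≤ : ∀ t {i j} → i ≤ j → j < p → p ∣ t + i * a → p ∣ t + j * a → i ≡ j
    solution-unique-≤ t {i} i≤j j<p p∣t+ia p∣t+ja with ℕ.m≤n⇒∃[o]m+o≡n i≤j
    ... | k , refl with euclidsLemma k a p-prime (∣m+n∣m⇒∣n (subst (p ∣_) (regroup t i k a) p∣t+ja) p∣t+ia)
      where
      regroup : ∀ t i k a → t + (i + k) * a ≡ t + i * a + k * a
      regroup = solve-∀
    ... | inj₂ p∣a = ⊥-elim (p∤a p∣a)
    ... | inj₁ p∣k with k
    ...   | zero   = sym (ℕ.+-identityʳ i)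
    ...   | suc k′ = ⊥-elim (ℕ.<-irrefl refl (ℕ.<-≤-trans j<p (ℕ.≤-trans (∣⇒≤ p∣k) (ℕ.m≤n+m (suc k′) i))))

  solution-unique : ∀ t {i j} → i < p → j < p → p ∣ t + i * a → p ∣ t + j * a → i ≡ j
  solution-unique t {i} {j} i<p j<p p∣t+ia p∣t+ja with ℕ.≤-total i j
  ... | inj₁ i≤j = solution-unique-≤ t i≤j j<p p∣t+ia p∣t+ja
  ... | inj₂ j≤i = sym (solution-unique-≤ t j≤i i<p p∣t+ja p∣t+ia)

  primeWeight-annihilates : ∀ t → ∑[ i < p ] primeWeight p (t + i * a) ≡ 0ℤ
  primeWeight-annihilates t = from-solution (∃-solution t)
    where
    open ≡-Reasoning
    𝟙[_] : ℕ → ℤ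
    𝟙[ i ] = 𝟙 (p ∣? t + i * a)
    from-solution : (∃ λ i → i < p × p ∣ t + i * a) → ∑[ i < p ] primeWeight p (t + i * a) ≡ 0ℤ
    from-solution (i₀ , i₀<p , p∣t+i₀a) = begin
      ∑[ i < p ] (+ p ℤ.* 𝟙[ i ] ℤ.+ -1ℤ)             ≡⟨ ∑-+ p (λ i → + p ℤ.* 𝟙[ i ]) (λ _ → -1ℤ) ⟩
      ∑[ i < p ] (+ p ℤ.* 𝟙[ i ]) ℤ.+ ∑[ i < p ] -1ℤ  ≡⟨ cong₂ ℤ._+_ (∑-*ˡ p (+ p) 𝟙[_]) (∑-const p -1ℤ) ⟩
      + p ℤ.* ∑[ i < p ] 𝟙[ i ] ℤ.+ + p ℤ.* -1ℤ      ≡⟨ cong (λ z → + p ℤ.* z ℤ.+ + p ℤ.* -1ℤ) exactly-one ⟩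
      + p ℤ.* 1ℤ ℤ.+ + p ℤ.* -1ℤ                     ≡⟨ ℤ.*-distribˡ-+ (+ p) 1ℤ -1ℤ ⟨
      + p ℤ.* 0ℤ                                     ≡⟨ ℤ.*-zeroʳ (+ p) ⟩
      0ℤ                                             ∎
      where
      exactly-one : ∑[ i < p ] 𝟙[ i ] ≡ 1ℤ
      exactly-one = trans (∑-single p 𝟙[_] i₀ i₀<p others) (𝟙-yes _ p∣t+i₀a)
        where
        others : ∀ i → i < p → i ≢ i₀ → 𝟙[ i ] ≡ 0ℤ
        others i i<p i≢i₀ = 𝟙-no _ (λ p∣t+ia → i≢i₀ (solution-unique t i<p i₀<p p∣t+ia p∣t+i₀a))

primeWeight-annihilator : ∀ {p} → Prime p → Annihilator p (primeWeight p)
primeWeight-annihilator {p} p-prime = record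
  { periodic    = λ t → cong (λ z → + p ℤ.* z ℤ.- 1ℤ) (𝟙-∣-periodic p t)
  ; annihilates = λ p∤a → primeWeight-annihilates p-prime p∤a
  ; nonzero     = nonzero p-prime
  }
  where
  nonzero : ∀ {p} → Prime p → primeWeight p 0 ≢ 0ℤ
  nonzero {suc (suc _)} _ ()

inflate : (p : ℕ) → .{{NonZero p}} → (ℕ → ℤ) → ℕ → ℤ
inflate p ψ t = 𝟙 (p ∣? t) ℤ.* ψ (t / p)

module _ {p k ψ} .{{_ : NonZero p}} (p∣k : p ∣ k) (ann : Annihilator k ψ) where
  open Annihilator ann

  private
    [t+qp]/p≡t/p+q : ∀ t q → (t + q * p) / p ≡ t / p + q
    [t+qp]/p≡t/p+q t q = trans (+-distrib-/-∣ʳ t (n∣m*n q)) (cong (_+_ (t / p)) (m*n/n≡m q p))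

    inflate-+* : ∀ t q → inflate p ψ (t + q * p) ≡ 𝟙 (p ∣? t) ℤ.* ψ (t / p + q)
    inflate-+* t q = cong₂ ℤ._*_ (Periodic-* (𝟙-∣-periodic p) q t) (cong ψ ([t+qp]/p≡t/p+q t q))

    inflate-0 : inflate p ψ 0 ≡ ψ 0
    inflate-0 = trans (cong₂ ℤ._*_ (𝟙-yes (p ∣? 0) (p ∣0)) (cong ψ (0/n≡0 p))) (ℤ.*-identityˡ (ψ 0))

  inflate-annihilator : Annihilator (p * k) (inflate p ψ)
  inflate-annihilator = record
    { periodic    = periodic′
    ; annihilates = annihilates′
    ; nonzero     = nonzero ∘ trans (sym inflate-0)
    }
    where
    open ≡-Reasoning
    periodic′ : Periodic (p * k) (inflate p ψ)
    periodic′ t = begin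
      inflate p ψ (t + p * k)           ≡⟨ cong (λ n → inflate p ψ (t + n)) (ℕ.*-comm p k) ⟩
      inflate p ψ (t + k * p)           ≡⟨ inflate-+* t k ⟩
      𝟙 (p ∣? t) ℤ.* ψ (t / p + k)      ≡⟨ cong (𝟙 (p ∣? t) ℤ.*_) (periodic (t / p)) ⟩
      inflate p ψ t                     ∎
    annihilates′ : ∀ {a} → p * k ∤ a → ∀ t → ∑[ i < p * k ] inflate p ψ (t + i * a) ≡ 0ℤ
    annihilates′ {a} pk∤a t with p ∣? a
    ... | yes (divides a′ refl) = begin
      ∑[ i < p * k ] inflate p ψ (t + i * (a′ * p))
        ≡⟨ ∑-cong (p * k) (λ i → trans (cong (λ n → inflate p ψ (t + n)) (sym (ℕ.*-assoc i a′ p))) (inflate-+* t (i * a′))) ⟩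
      ∑[ i < p * k ] (𝟙 (p ∣? t) ℤ.* ψ (t / p + i * a′))
        ≡⟨ ∑-*ˡ (p * k) (𝟙 (p ∣? t)) (λ i → ψ (t / p + i * a′)) ⟩
      𝟙 (p ∣? t) ℤ.* ∑[ i < p * k ] ψ (t / p + i * a′)
        ≡⟨ cong (𝟙 (p ∣? t) ℤ.*_) (annihilates-* k∤a′ p (t / p)) ⟩
      𝟙 (p ∣? t) ℤ.* 0ℤ
        ≡⟨ ℤ.*-zeroʳ (𝟙 (p ∣? t)) ⟩
      0ℤ ∎
      where
      k∤a′ : k ∤ a′
      k∤a′ k∣a′ = pk∤a (subst (p * k ∣_) (ℕ.*-comm p a′) (*-monoʳ-∣ p k∣a′))
    ... | no p∤a = begin
      ∑[ i < p * k ] inflate p ψ (t + i * a)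
        ≡⟨ cong (λ n → ∑[ i < n ] inflate p ψ (t + i * a)) (ℕ.*-comm p k) ⟩
      ∑[ i < k * p ] inflate p ψ (t + i * a)
        ≡⟨ ∑-*-periodic (Periodic-progression (𝟙-∣-periodic p) t a) k (λ i → ψ ((t + i * a) / p)) ⟩
      ∑[ r < p ] (𝟙 (p ∣? t + r * a) ℤ.* ∑[ j < k ] ψ ((t + (j * p + r) * a) / p))
        ≡⟨ ∑-*-vanishes p (λ r → 𝟙 (p ∣? t + r * a)) inner ⟩
      0ℤ ∎
      where
      regroup : ∀ t j p r a → t + (j * p + r) * a ≡ t + r * a + j * a * p
      regroup = solve-∀
      k∤a : k ∤ a
      k∤a = p∤a ∘ ∣-trans p∣k
      inner : ∀ r → ∑[ j < k ] ψ ((t + (j * p + r) * a) / p) ≡ 0ℤ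
      inner r = trans (∑-cong k (λ j → cong ψ (trans (cong (_/ p) (regroup t j p r a))
                                                     ([t+qp]/p≡t/p+q (t + r * a) (j * a)))))
                      (annihilates k∤a ((t + r * a) / p))

module _ {p k ψ} (p-prime : Prime p) (p∤k : p ∤ k) (ann : Annihilator k ψ) where
  open Annihilator ann
  private
    φ = primeWeight p
    module Φ = Annihilator (primeWeight-annihilator p-prime)

    progression-regroup : ∀ t j c r a → t + (j * c + r) * a ≡ t + r * a + j * (c * a)
    progression-regroup = solve-∀

  product-annihilator : Annihilator (p * k) (λ t → φ t ℤ.* ψ t)
  product-annihilator = record
    { periodic    = λ t → cong₂ ℤ._*_ (Periodic-∣ Φ.periodic (m∣m*n k) t) (Periodic-∣ periodic (n∣m*n p) t)
    ; annihilates = annihilates′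
    ; nonzero     = λ φ0ψ0≡0 → [ Φ.nonzero , nonzero ]′ (ℤ.i*j≡0⇒i≡0∨j≡0 (φ 0) φ0ψ0≡0)
    }
    where
    open ≡-Reasoning
    annihilates′ : ∀ {a} → p * k ∤ a → ∀ t → ∑[ i < p * k ] (φ (t + i * a) ℤ.* ψ (t + i * a)) ≡ 0ℤ
    annihilates′ {a} pk∤a t with p ∣? a
    ... | no p∤a = begin
      ∑[ i < p * k ] (φ (t + i * a) ℤ.* ψ (t + i * a))
        ≡⟨ ∑-cong (p * k) (λ i → ℤ.*-comm (φ (t + i * a)) (ψ (t + i * a))) ⟩
      ∑[ i < p * k ] (ψ (t + i * a) ℤ.* φ (t + i * a))
        ≡⟨ ∑-*-periodic (Periodic-progression periodic t a) p (λ i → φ (t + i * a)) ⟩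
      ∑[ r < k ] (ψ (t + r * a) ℤ.* ∑[ j < p ] φ (t + (j * k + r) * a))
        ≡⟨ ∑-*-vanishes k (λ r → ψ (t + r * a)) inner ⟩
      0ℤ ∎
      where
      p∤ka : p ∤ k * a
      p∤ka p∣ka = [ p∤k , p∤a ]′ (euclidsLemma k a p-prime p∣ka)
      inner : ∀ r → ∑[ j < p ] φ (t + (j * k + r) * a) ≡ 0ℤ
      inner r = trans (∑-cong p (λ j → cong φ (progression-regroup t j k r a))) (Φ.annihilates p∤ka (t + r * a))
    ... | yes (divides a′ refl) = begin
      ∑[ i < p * k ] (φ (t + i * a) ℤ.* ψ (t + i * a))
        ≡⟨ cong (λ n → ∑[ i < n ] (φ (t + i * a) ℤ.* ψ (t + i * a))) (ℕ.*-comm p k) ⟩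
      ∑[ i < k * p ] (φ (t + i * a) ℤ.* ψ (t + i * a))
        ≡⟨ ∑-*-periodic (Periodic-progression Φ.periodic t a) k (λ i → ψ (t + i * a)) ⟩
      ∑[ r < p ] (φ (t + r * a) ℤ.* ∑[ j < k ] ψ (t + (j * p + r) * a))
        ≡⟨ ∑-*-vanishes p (λ r → φ (t + r * a)) inner ⟩
      0ℤ ∎
      where
      k∤pa : k ∤ p * a
      k∤pa k∣pa = pk∤a (subst (p * k ∣_) (ℕ.*-comm p a′) (*-monoʳ-∣ p k∣a′))
        where
        k∣a′ : k ∣ a′
        k∣a′ = coprime-divisor k⊥p (subst (k ∣_) (ℕ.*-comm a′ p) (coprime-divisor k⊥p k∣pa))
          where k⊥p = Coprime.sym (prime∤⇒coprime p-prime p∤k)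
      inner : ∀ r → ∑[ j < k ] ψ (t + (j * p + r) * a) ≡ 0ℤ
      inner r = trans (∑-cong k (λ j → cong ψ (progression-regroup t j p r a))) (annihilates k∤pa (t + r * a))

annihilator-of-primes : ∀ ps → All Prime ps → Σ (ℕ → ℤ) (Annihilator (product ps))
annihilator-of-primes []       []                = (λ _ → 1ℤ) , record
  { periodic    = λ _ → refl
  ; annihilates = λ 1∤a → ⊥-elim (1∤a (1∣ _))
  ; nonzero     = λ ()
  }
annihilator-of-primes (p ∷ ps) (p-prime ∷ ps-prime) with annihilator-of-primes ps ps-prime | p ∣? product ps
... | ψ , ann | yes p∣k = inflate p ψ , inflate-annihilator p∣k ann
  where instance _ = prime⇒nonZero p-prime
... | ψ , ann | no p∤k  = _ , product-annihilator p-prime p∤k ann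

annihilator : ∀ m .{{_ : NonZero m}} → Σ (ℕ → ℤ) (Annihilator m)
annihilator m = subst (λ n → Σ (ℕ → ℤ) (Annihilator n)) (sym isFactorisation) (annihilator-of-primes factors factorsPrime)
  where open PrimeFactorisation (factorise m)

-- Weighted sums along one coordinate

infix 4 _∣ᵤ?_
_∣ᵤ?_ : (k z : ℤ) → Dec (k ℤ∣.∣ z)
k ∣ᵤ? z = ℤ.∣ k ∣ ∣? ℤ.∣ z ∣

∣m+n∣n⇒∣mᵤ : ∀ k x y → k ℤ∣.∣ y → k ℤ∣.∣ x ℤ.+ y → k ℤ∣.∣ x
∣m+n∣n⇒∣mᵤ k x y k∣y k∣x+y =
  ℤ∣ˢ.∣⇒∣ᵤ {k} {x} (ℤ∣ˢ.∣m+n∣n⇒∣m (ℤ∣ˢ.∣ᵤ⇒∣ {k} {x ℤ.+ y} k∣x+y) (ℤ∣ˢ.∣ᵤ⇒∣ {k} {y} k∣y))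

∣m∣n⇒∣m+nᵤ : ∀ k x y → k ℤ∣.∣ x → k ℤ∣.∣ y → k ℤ∣.∣ x ℤ.+ y
∣m∣n⇒∣m+nᵤ k x y k∣x k∣y =
  ℤ∣ˢ.∣⇒∣ᵤ {k} {x ℤ.+ y} (ℤ∣ˢ.∣m∣n⇒∣m+n (ℤ∣ˢ.∣ᵤ⇒∣ {k} {x} k∣x) (ℤ∣ˢ.∣ᵤ⇒∣ {k} {y} k∣y))

m∣[z%ℕm]-z : ∀ z m .{{_ : NonZero m}} → + m ℤ∣.∣ + (z %ℕ m) ℤ.- z
m∣[z%ℕm]-z z m = ℤ∣ˢ.∣⇒∣ᵤ {+ m} {+ (z %ℕ m) ℤ.- z} (ℤ∣ˢ.divides (- (z /ℕ m)) (begin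
  + (z %ℕ m) ℤ.- z                                      ≡⟨ cong (ℤ._-_ (+ (z %ℕ m))) (a≡a%ℕn+[a/ℕn]*n z m) ⟩
  + (z %ℕ m) ℤ.- (+ (z %ℕ m) ℤ.+ (z /ℕ m) ℤ.* + m)      ≡⟨ cancel (+ (z %ℕ m)) (z /ℕ m) (+ m) ⟩
  - (z /ℕ m) ℤ.* + m                                    ∎))
  where
  open ≡-Reasoning
  cancel : ∀ r q m → r ℤ.- (r ℤ.+ q ℤ.* m) ≡ - q ℤ.* m
  cancel = ℤ-Solver.solve-∀

residue : ℕ → ℤ → ℕ → ℤ
residue a v t = 𝟙 (+ a ∣ᵤ? (+ t ℤ.- v))

residue-periodic : ∀ a v → Periodic a (residue a v)
residue-periodic a v t = 𝟙-cong (λ h → ∣m+n∣n⇒∣mᵤ (+ a) (+ t ℤ.- v) (+ a) a∣a (subst (+ a ℤ∣.∣_) shift h))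
                                (λ h → subst (+ a ℤ∣.∣_) (sym shift) (∣m∣n⇒∣m+nᵤ (+ a) (+ t ℤ.- v) (+ a) h a∣a)) _ _
  where
  a∣a : + a ℤ∣.∣ + a
  a∣a = ∣-refl
  shift : + (t + a) ℤ.- v ≡ (+ t ℤ.- v) ℤ.+ + a
  shift = trans (cong (ℤ._- v) (ℤ.pos-+ t a)) (swap (+ t) (+ a) v)
    where
    swap : ∀ t a v → t ℤ.+ a ℤ.- v ≡ t ℤ.- v ℤ.+ a
    swap = ℤ-Solver.solve-∀

module _ {m ψ} (ann : Annihilator m ψ) where
  open Annihilator ann

  periodic-weighted-sum-vanishes : ∀ {a g} → m ∤ a → Periodic a g → ∀ c → a ∣ c → ∀ C →
                                   ∑[ t < c * m ] (g t ℤ.* ψ (t + C)) ≡ 0ℤ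
  periodic-weighted-sum-vanishes {a} {g} m∤a per _ (divides q refl) C = begin
    ∑[ t < q * a * m ] (g t ℤ.* ψ (t + C))
      ≡⟨ cong (λ n → ∑[ t < n ] (g t ℤ.* ψ (t + C))) (reorder q a m) ⟩
    ∑[ t < q * m * a ] (g t ℤ.* ψ (t + C))
      ≡⟨ ∑-*-periodic per (q * m) (λ t → ψ (t + C)) ⟩
    ∑[ r < a ] (g r ℤ.* ∑[ j < q * m ] ψ (j * a + r + C))
      ≡⟨ ∑-*-vanishes a g inner ⟩
    0ℤ ∎
    where
    open ≡-Reasoning
    reorder : ∀ q a m → q * a * m ≡ q * m * a
    reorder = solve-∀
    regroup : ∀ j a r C → j * a + r + C ≡ r + C + j * a
    regroup = solve-∀
    inner : ∀ r → ∑[ j < q * m ] ψ (j * a + r + C) ≡ 0ℤ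
    inner r = trans (∑-cong (q * m) (λ j → cong ψ (regroup j a r C))) (annihilates-* m∤a q (r + C))

  residue-weighted-sum-nonzero : .{{_ : NonZero m}} → ∀ c .{{_ : NonZero c}} v C → + m ℤ∣.∣ + C ℤ.+ v →
                                 ∑[ t < c * m ] (residue m v t ℤ.* ψ (t + C)) ≢ 0ℤ
  residue-weighted-sum-nonzero c v C m∣C+v sum≡0 =
    [ ℤ.<⇒≢ count-pos ∘ sym , nonzero ]′ (ℤ.i*j≡0⇒i≡0∨j≡0 count (trans (sym factored) sum≡0))
    where
    count : ℤ
    count = ∑[ t < c * m ] residue m v t
    count-pos : 0ℤ ℤ.< count
    count-pos = ∑-pos (c * m) (v %ℕ m) (λ t → 𝟙-nonneg _) (ℕ.<-≤-trans (n%ℕd<d v m) (ℕ.m≤n*m m c))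
                      (subst (0ℤ ℤ.<_) (sym (𝟙-yes _ (m∣[z%ℕm]-z v m))) (ℤ.+<+ (ℕ.n<1+n 0)))
    on-residue : ∀ t → residue m v t ℤ.* ψ (t + C) ≡ residue m v t ℤ.* ψ 0
    on-residue t with + m ∣ᵤ? (+ t ℤ.- v)
    ... | no _      = refl
    ... | yes m∣t-v = cong (1ℤ ℤ.*_) (Periodic-∣ periodic m∣t+C 0)
      where
      m∣t+C : m ∣ t + C
      m∣t+C = subst (+ m ℤ∣.∣_) (trans (cancel (+ t) v (+ C)) (sym (ℤ.pos-+ t C)))
                    (∣m∣n⇒∣m+nᵤ (+ m) (+ t ℤ.- v) (+ C ℤ.+ v) m∣t-v m∣C+v)
        where
        cancel : ∀ t v C → t ℤ.- v ℤ.+ (C ℤ.+ v) ≡ t ℤ.+ C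
        cancel = ℤ-Solver.solve-∀
    factored : ∑[ t < c * m ] (residue m v t ℤ.* ψ (t + C)) ≡ count ℤ.* ψ 0
    factored = trans (∑-cong (c * m) on-residue) (∑-*ʳ (c * m) (ψ 0) (residue m v))

-- Weighted masses of Cartesian cosets

∑ᶠ : ∀ n → (Fin n → ℤ) → ℤ
∑ᶠ zero    f = 0ℤ
∑ᶠ (suc n) f = head f ℤ.+ ∑ᶠ n (tail f)

∏ᶠ : ∀ n → (Fin n → ℤ) → ℤ
∏ᶠ zero    f = 1ℤ
∏ᶠ (suc n) f = head f ℤ.* ∏ᶠ n (tail f)

∑ᶠ-cong : ∀ n {f g} → (∀ i → f i ≡ g i) → ∑ᶠ n f ≡ ∑ᶠ n g
∑ᶠ-cong zero    f≗g = refl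
∑ᶠ-cong (suc n) f≗g = cong₂ ℤ._+_ (f≗g zero) (∑ᶠ-cong n (f≗g ∘ suc))

∑ᶠ-vanishes : ∀ n {f} → (∀ i → f i ≡ 0ℤ) → ∑ᶠ n f ≡ 0ℤ
∑ᶠ-vanishes zero    f≗0 = refl
∑ᶠ-vanishes (suc n) f≗0 = cong₂ ℤ._+_ (f≗0 zero) (∑ᶠ-vanishes n (f≗0 ∘ suc))

∑ᶠ-single : ∀ n f i₀ → (∀ i → i ≢ i₀ → f i ≡ 0ℤ) → ∑ᶠ n f ≡ f i₀
∑ᶠ-single (suc n) f zero     others =
  trans (cong (ℤ._+_ (f zero)) (∑ᶠ-vanishes n (λ i → others (suc i) λ ()))) (ℤ.+-identityʳ (f zero))
∑ᶠ-single (suc n) f (suc i₀) others =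
  trans (cong₂ ℤ._+_ (others zero λ ()) (∑ᶠ-single n (tail f) i₀ (λ i i≢i₀ → others (suc i) (i≢i₀ ∘ Fin.suc-injective))))
        (ℤ.+-identityˡ (f (suc i₀)))

∏ᶠ-zero : ∀ n f (j : Fin n) → f j ≡ 0ℤ → ∏ᶠ n f ≡ 0ℤ
∏ᶠ-zero (suc n) f zero    fj≡0 = cong (ℤ._* ∏ᶠ n (tail f)) fj≡0
∏ᶠ-zero (suc n) f (suc j) fj≡0 = trans (cong (f zero ℤ.*_) (∏ᶠ-zero n (tail f) j fj≡0)) (ℤ.*-zeroʳ (f zero))

∏ᶠ-nonzero : ∀ n f → (∀ j → f j ≢ 0ℤ) → ∏ᶠ n f ≢ 0ℤ
∏ᶠ-nonzero (suc n) f f≢0 ∏≡0 = [ f≢0 zero , ∏ᶠ-nonzero n (tail f) (f≢0 ∘ suc) ]′ (ℤ.i*j≡0⇒i≡0∨j≡0 (f zero) ∏≡0)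

∏ᶠ-𝟙 : ∀ n {P : Fin n → Set} (P? : ∀ j → Dec (P j)) f → (∀ j → P j) → ∏ᶠ n (λ j → 𝟙 (P? j) ℤ.* f j) ≡ ∏ᶠ n f
∏ᶠ-𝟙 zero    P? f all = refl
∏ᶠ-𝟙 (suc n) P? f all = cong₂ ℤ._*_ (trans (cong (ℤ._* f zero) (𝟙-yes (P? zero) (all zero))) (ℤ.*-identityˡ (f zero)))
                                   (∏ᶠ-𝟙 n (P? ∘ suc) (tail f) (all ∘ suc))

∑□ : ∀ d → (Fin d → ℕ) → ((Fin d → ℕ) → ℤ) → ℤ
∑□ zero    M F = F (λ ())
∑□ (suc d) M F = ∑[ t < head M ] ∑□ d (tail M) (λ x → F (t Vector.∷ x))

∑□-cong : ∀ d M {F G} → (∀ x → F x ≡ G x) → ∑□ d M F ≡ ∑□ d M G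
∑□-cong zero    M F≗G = F≗G _
∑□-cong (suc d) M F≗G = ∑-cong (head M) (λ t → ∑□-cong d (tail M) (F≗G ∘ (t Vector.∷_)))

∑□-zero : ∀ d M → ∑□ d M (λ _ → 0ℤ) ≡ 0ℤ
∑□-zero zero    M = refl
∑□-zero (suc d) M = ∑-vanishes (head M) (λ t _ → ∑□-zero d (tail M))

∑□-+ : ∀ d M F G → ∑□ d M (λ x → F x ℤ.+ G x) ≡ ∑□ d M F ℤ.+ ∑□ d M G
∑□-+ zero    M F G = refl
∑□-+ (suc d) M F G = trans (∑-cong (head M) (λ t → ∑□-+ d (tail M) _ _)) (∑-+ (head M) _ _)

∑□-*ˡ : ∀ d M c F → ∑□ d M (λ x → c ℤ.* F x) ≡ c ℤ.* ∑□ d M F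
∑□-*ˡ zero    M c F = refl
∑□-*ˡ (suc d) M c F = trans (∑-cong (head M) (λ t → ∑□-*ˡ d (tail M) c _)) (∑-*ˡ (head M) c _)

∑□-∑ᶠ : ∀ d M n (F : Fin n → (Fin d → ℕ) → ℤ) → ∑□ d M (λ x → ∑ᶠ n (λ i → F i x)) ≡ ∑ᶠ n (λ i → ∑□ d M (F i))
∑□-∑ᶠ d M zero    F = ∑□-zero d M
∑□-∑ᶠ d M (suc n) F = trans (∑□-+ d M _ _) (cong (ℤ._+_ (∑□ d M (F zero))) (∑□-∑ᶠ d M n (F ∘ suc)))

∑□-∏ᶠ : ∀ d M (f : Fin d → ℕ → ℤ) → ∑□ d M (λ x → ∏ᶠ d (λ j → f j (x j))) ≡ ∏ᶠ d (λ j → ∑ (M j) (f j))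
∑□-∏ᶠ zero    M f = refl
∑□-∏ᶠ (suc d) M f = begin
  ∑[ t < head M ] ∑□ d (tail M) (λ x → f zero t ℤ.* ∏ᶠ d (λ j → f (suc j) (x j)))
    ≡⟨ ∑-cong (head M) (λ t → ∑□-*ˡ d (tail M) (f zero t) _) ⟩
  ∑[ t < head M ] (f zero t ℤ.* ∑□ d (tail M) (λ x → ∏ᶠ d (λ j → f (suc j) (x j))))
    ≡⟨ ∑-cong (head M) (λ t → cong (ℤ._*_ (f zero t)) (∑□-∏ᶠ d (tail M) (f ∘ suc))) ⟩
  ∑[ t < head M ] (f zero t ℤ.* ∏ᶠ d (λ j → ∑ (M (suc j)) (f (suc j))))
    ≡⟨ ∑-*ʳ (head M) _ (f zero) ⟩
  ∑ (head M) (f zero) ℤ.* ∏ᶠ d (λ j → ∑ (M (suc j)) (f (suc j))) ∎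
  where open ≡-Reasoning

module _ {d} (M : Fin d → ℕ) (w : Fin d → ℕ → ℤ) where

  mass : Coset d → ℤ
  mass C = ∏ᶠ d (λ j → ∑[ t < M j ] (residue (moduli C j) (base C j) t ℤ.* w j t))

  mass-additive : ∀ {n} {T : Fin n → Coset d} → IsTiling T → ∑ᶠ n (mass ∘ T) ≡ ∏ᶠ d (λ j → ∑ (M j) (w j))
  mass-additive {n} {T} (_ , disjoint , cover) = begin
    ∑ᶠ n (mass ∘ T)                                 ≡⟨ ∑ᶠ-cong n (λ i → ∑□-∏ᶠ d M (weight (T i))) ⟨
    ∑ᶠ n (λ i → ∑□ d M (∏weight (T i)))             ≡⟨ ∑□-∑ᶠ d M n (∏weight ∘ T) ⟨
    ∑□ d M (λ x → ∑ᶠ n (λ i → ∏weight (T i) x))     ≡⟨ ∑□-cong d M partition ⟩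
    ∑□ d M (λ x → ∏ᶠ d (λ j → w j (x j)))           ≡⟨ ∑□-∏ᶠ d M w ⟩
    ∏ᶠ d (λ j → ∑ (M j) (w j))                      ∎
    where
    open ≡-Reasoning
    weight : Coset d → Fin d → ℕ → ℤ
    weight C j t = residue (moduli C j) (base C j) t ℤ.* w j t
    ∏weight : Coset d → (Fin d → ℕ) → ℤ
    ∏weight C x = ∏ᶠ d (λ j → weight C j (x j))
    partition : ∀ x → ∑ᶠ n (λ i → ∏weight (T i) x) ≡ ∏ᶠ d (λ j → w j (x j))
    partition x = from-cover (cover (λ j → + x j))
      where
      member? : ∀ C j → Dec (+ moduli C j ℤ∣.∣ + x j ℤ.- base C j)
      member? C j = + moduli C j ∣ᵤ? + x j ℤ.- base C j
      outside : ∀ {i₀} → (λ j → + x j) ∈C T i₀ → ∀ i → i ≢ i₀ → ∏weight (T i) x ≡ 0ℤ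
      outside {i₀} x∈Ti₀ i i≢i₀ with Fin.¬∀⟶∃¬ d _ (member? (T i)) (λ x∈Ti → disjoint i i₀ i≢i₀ (λ j → + x j) x∈Ti x∈Ti₀)
      ... | j , x∉Tij = ∏ᶠ-zero d _ j (cong (ℤ._* w j (x j)) (𝟙-no (member? (T i) j) x∉Tij))
      from-cover : ∃ (λ i₀ → (λ j → + x j) ∈C T i₀) → ∑ᶠ n (λ i → ∏weight (T i) x) ≡ ∏ᶠ d (λ j → w j (x j))
      from-cover (i₀ , x∈Ti₀) = trans (∑ᶠ-single n _ i₀ (outside x∈Ti₀)) (∏ᶠ-𝟙 d (member? (T i₀)) (λ j → w j (x j)) x∈Ti₀)

-- The tiling argument

Isolated : ∀ {d n} → (Fin n → Coset d) → Fin n → Set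
Isolated T k = ∀ i → i ≢ k → ∃ λ j → moduli (T k) j ∤ moduli (T i) j

∃-other : ∀ {n} → 2 ≤ n → (k : Fin n) → ∃ λ i → i ≢ k
∃-other (s≤s (s≤s _)) zero    = suc zero , λ ()
∃-other (s≤s (s≤s _)) (suc k) = zero , λ ()

tiling⇒¬isolated : ∀ {d n} {T : Fin n → Coset d} → IsTiling T → ∀ k → ¬ Isolated T k
tiling⇒¬isolated {d} {n} {T} tiling@(2≤n , _ , _) k isolated = mass-nonzero (begin
  mass M w (T k)                  ≡⟨ ∑ᶠ-single n (mass M w ∘ T) k other-mass-vanishes ⟨
  ∑ᶠ n (mass M w ∘ T)             ≡⟨ mass-additive M w {T = T} tiling ⟩
  ∏ᶠ d (λ j → ∑ (M j) (w j))      ≡⟨ total-vanishes ⟩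
  0ℤ                              ∎)
  where
  open ≡-Reasoning
  m : Fin d → ℕ
  m = moduli (T k)
  instance
    m≢0 : ∀ {j} → NonZero (m j)
    m≢0 {j} = >-nonZero (moduli-pos (T k) j)
  ψ : Fin d → ℕ → ℤ
  ψ j = proj₁ (annihilator (m j))
  ann : ∀ j → Annihilator (m j) (ψ j)
  ann j = proj₂ (annihilator (m j))
  -- Since C j ≡ − base (T k) j (mod m j), the weight w j t is ψ j evaluated at t − base (T k) j.
  C : Fin d → ℕ
  C j = (- base (T k) j) %ℕ m j
  w : Fin d → ℕ → ℤ
  w j t = ψ j (t + C j)
  L : Fin d → ℕ
  L j = product (tabulate (λ i → moduli (T i) j))
  L-multiple : ∀ i j → moduli (T i) j ∣ L j
  L-multiple i j = ∈⇒∣product (∈-tabulate⁺ i)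
  instance
    L≢0 : ∀ {j} → NonZero (L j)
    L≢0 {j} = product≢0 (tabulate⁺ (λ i → >-nonZero (moduli-pos (T i) j)))
  M : Fin d → ℕ
  M j = L j * m j

  other-mass-vanishes : ∀ i → i ≢ k → mass M w (T i) ≡ 0ℤ
  other-mass-vanishes i i≢k with isolated i i≢k
  ... | j , m∤a = ∏ᶠ-zero d _ j (periodic-weighted-sum-vanishes (ann j) m∤a (residue-periodic (moduli (T i) j) (base (T i) j))
                                                                (L j) (L-multiple i j) (C j))

  total-vanishes : ∏ᶠ d (λ j → ∑ (M j) (w j)) ≡ 0ℤ
  total-vanishes with ∃-other 2≤n k
  ... | i , i≢k with isolated i i≢k
  ... | j , m∤a = ∏ᶠ-zero d _ j (trans (∑-cong (M j) (λ t → sym (ℤ.*-identityˡ (w j t))))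
                                       (periodic-weighted-sum-vanishes (ann j) {g = λ _ → 1ℤ} m∤1 (λ _ → refl) (L j) (1∣ _) (C j)))
    where
    m∤1 : m j ∤ 1
    m∤1 m∣1 = m∤a (∣-trans m∣1 (1∣ _))

  mass-nonzero : mass M w (T k) ≢ 0ℤ
  mass-nonzero = ∏ᶠ-nonzero d _ (λ j → residue-weighted-sum-nonzero (ann j) (L j) (base (T k) j) (C j) (m∣C+v j))
    where
    m∣C+v : ∀ j → + m j ℤ∣.∣ + C j ℤ.+ base (T k) j
    m∣C+v j = subst (+ m j ℤ∣.∣_) (cong (ℤ._+_ (+ C j)) (ℤ.neg-involutive (base (T k) j))) (m∣[z%ℕm]-z (- base (T k) j) (m j))

∃-other-tile-with-multiple-moduli : ∀ {d n} {T : Fin n → Coset d} → IsTiling T → ∀ k →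
                                    ∃ λ i → i ≢ k × (∀ j → moduli (T k) j ∣ moduli (T i) j)
∃-other-tile-with-multiple-moduli {d} {n} {T} tiling k
  with Fin.any? (λ i → ¬? (i Fin.≟ k) ×-dec Fin.all? (λ j → moduli (T k) j ∣? moduli (T i) j))
... | yes found = found
... | no none   = contradiction isolated (tiling⇒¬isolated {T = T} tiling k)
  where
  isolated : Isolated T k
  isolated i i≢k = Fin.¬∀⟶∃¬ d _ (λ j → moduli (T k) j ∣? moduli (T i) j) (λ divides → none (i , i≢k , divides))

sumℕ : ∀ d → (Fin d → ℕ) → ℕ
sumℕ zero    f = 0
sumℕ (suc d) f = f zero + sumℕ d (f ∘ suc)

sumℕ-mono-≤ : ∀ d {f g} → (∀ j → f j ≤ g j) → sumℕ d f ≤ sumℕ d g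
sumℕ-mono-≤ zero    f≤g = z≤n
sumℕ-mono-≤ (suc d) f≤g = ℕ.+-mono-≤ (f≤g zero) (sumℕ-mono-≤ d (f≤g ∘ suc))

sumℕ-≤⇒≡ : ∀ d {f g} → (∀ j → f j ≤ g j) → sumℕ d g ≤ sumℕ d f → ∀ j → f j ≡ g j
sumℕ-≤⇒≡ (suc d) {f} {g} f≤g Σg≤Σf zero    = ℕ.≤-antisym (f≤g zero)
  (ℕ.+-cancelʳ-≤ _ _ _ (ℕ.≤-trans (ℕ.+-monoʳ-≤ (g zero) (sumℕ-mono-≤ d (f≤g ∘ suc))) Σg≤Σf))
sumℕ-≤⇒≡ (suc d) {f} {g} f≤g Σg≤Σf (suc j) = sumℕ-≤⇒≡ d (f≤g ∘ suc)
  (ℕ.+-cancelˡ-≤ (f zero) _ _ (ℕ.≤-trans (ℕ.+-monoˡ-≤ (sumℕ d (g ∘ suc)) (f≤g zero)) Σg≤Σf)) j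

∃-maximum : ∀ {n} (f : Fin (suc n) → ℕ) → ∃ λ k → ∀ i → f i ≤ f k
∃-maximum {n} f = argmax f zero (allFin (suc n)) ,
                  λ i → All.lookup (f[xs]≤f[argmax] {f = f} zero (allFin (suc n))) (∈-allFin i)

equal-moduli⇒translate : ∀ {d} {C C′ : Coset d} → (∀ j → moduli C j ≡ moduli C′ j) →
                         IsTranslateBy (λ j → base C′ j ℤ.- base C j) C C′
equal-moduli⇒translate {C = C} {C′} a≡a′ x =
  (λ x∈C′ j → subst₂ modulus-divides (sym (a≡a′ j)) (sym (shift j)) (x∈C′ j)) ,
  (λ x-w∈C j → subst₂ modulus-divides (a≡a′ j) (shift j) (x-w∈C j))
  where
  modulus-divides : ℕ → ℤ → Set
  modulus-divides a z = + a ℤ∣.∣ z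
  cancel : ∀ x b′ b → x ℤ.- (b′ ℤ.- b) ℤ.- b ≡ x ℤ.- b′
  cancel = ℤ-Solver.solve-∀
  shift : ∀ j → x j ℤ.- (base C′ j ℤ.- base C j) ℤ.- base C j ≡ x j ℤ.- base C′ j
  shift j = cancel (x j) (base C′ j) (base C j)

mainTheorem1 : (d : ℕ) → d ≥ 1 → (n : ℕ) → (T : Fin n → Coset d) → IsTiling T
    → Σ (Fin n) λ i → Σ (Fin n) λ j → ¬ (i ≡ j) × ∃ λ (w : Point d) → IsTranslateBy w (T i) (T j)
mainTheorem1 d _ zero    T (() , _)
mainTheorem1 d _ (suc n) T tiling with ∃-maximum (sumℕ d ∘ moduli ∘ T)
... | k , maximal with ∃-other-tile-with-multiple-moduli {T = T} tiling k
... | i , i≢k , k∣i = k , i , i≢k ∘ sym , _ , equal-moduli⇒translate {C = T k} {T i} equal-moduli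
  where
  equal-moduli : ∀ j → moduli (T k) j ≡ moduli (T i) j
  equal-moduli = sumℕ-≤⇒≡ d (λ j → ∣⇒≤ ⦃ >-nonZero (moduli-pos (T i) j) ⦄ (k∣i j)) (maximal i)
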